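{- Let $D$ be any number and put $A=D-2$, $B=-3D+6$, $C=-D+3$. Then for every integer $n\ge 0$, \begin{align*} \sum_{\substack{k_1+k_2+k_3=n\\ k_1,k_2,k_3\ge 1}}\binom{n}{k_1,k_2,k_3}T_{k_1}T_{k_2}T_{k_3} &=\frac{A}{44}3^nT_{n}^{(3,3,5)}+\frac{B}{44}+\frac{C}{22}\sum_{k=0}^n\binom{n}{k}2^{n-k}T_{n-k}^{(2,3,10)}T_k\\ &\quad+\frac{D}{22}\sum_{\substack{k_1+k_2+k_3=n\\ k_1,k_2,k_3\ge0}}\binom{n}{k_1,k_2,k_3}(-1)^{k_1}T_{k_1}^{(-1,2,7)}T_{k_2}. \end{align*}
   Context: The Tribonacci numbers are $T_n=T_n^{(0,1,1)}$, where for numbers $s_0,s_1,s_2$ the sequence $T_n^{(s_0,s_1,s_2)}$ is defined by $T_0^{(s_0,s_1,s_2)}=s_0$, $T_1^{(s_0,s_1,s_2)}=s_1$, $T_2^{(s_0,s_1,s_2)}=s_2$ and $T_n^{(s_0,s_1,s_2)}=T_{n-1}^{(s_0,s_1,s_2)}+T_{n-2}^{(s_0,s_1,s_2)}+T_{n-3}^{(s_0,s_1,s_2)}$ for $n\ge3$. $\binom{n}{k_1,\dots,k_r}=\frac{n!}{k_1!\cdots k_r!}$ denotes the multinomial coefficient. -}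

module Defs where

open import Data.Nat using (ℕ; zero; suc; _∸_; _≤ᵇ_)
import Data.Nat as ℕ
open import Data.Nat.Properties using (_!≢0; m*n≢0)
open import Data.Bool using (Bool; _∧_; if_then_else_)
open import Data.Integer using (ℤ)
import Data.Integer as ℤ
open import Data.Rational using (ℚ; 0ℚ; _+_)

Trib : ℤ → ℤ → ℤ → ℕ → ℤ
Trib s0 s1 s2 zero = s0
Trib s0 s1 s2 (suc zero) = s1
Trib s0 s1 s2 (suc (suc zero)) = s2
Trib s0 s1 s2 (suc (suc (suc n))) =
  Trib s0 s1 s2 (suc (suc n)) ℤ.+ Trib s0 s1 s2 (suc n) ℤ.+ Trib s0 s1 s2 n

T : ℕ → ℤ
T = Trib (ℤ.+ 0) (ℤ.+ 1) (ℤ.+ 1)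

multinomial3 : ℕ → ℕ → ℕ → ℕ → ℕ
multinomial3 n k1 k2 k3 = (n ℕ.!) ℕ./ ((k1 ℕ.! ℕ.* k2 ℕ.!) ℕ.* k3 ℕ.!)
  where instance
    _ = m*n≢0 (k1 ℕ.! ℕ.* k2 ℕ.!) (k3 ℕ.!) {{m*n≢0 (k1 ℕ.!) (k2 ℕ.!) {{k1 !≢0}} {{k2 !≢0}}}} {{k3 !≢0}}

sumTo : ℕ → (ℕ → ℚ) → ℚ
sumTo zero f = f 0
sumTo (suc n) f = sumTo n f + f (suc n)

sumComp3 : ℕ → (ℕ → ℕ → ℕ → ℚ) → ℚ
sumComp3 n f = sumTo n (λ k1 → sumTo (n ∸ k1) (λ k2 → f k1 k2 (n ∸ k1 ∸ k2)))

sumComp3Pos : ℕ → (ℕ → ℕ → ℕ → ℚ) → ℚ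
sumComp3Pos n f = sumComp3 n (λ k1 k2 k3 →
  if (1 ≤ᵇ k1) ∧ (1 ≤ᵇ k2) ∧ (1 ≤ᵇ k3) then f k1 k2 k3 else 0ℚ)

{-# OPTIONS --safe #-}
-- Every sum in the identity is a binomial convolution (f ⋆ g) n = Σₖ C(n,k) f k g (n − k),
-- that is, a product of exponential generating functions.  If f and g solve linear
-- recurrences with characteristic roots αᵢ and βⱼ, then f ⋆ g splits into solutions of
-- recurrences with roots αᵢ + βⱼ.  With αᵢ the Tribonacci roots (α₁ + α₂ + α₃ = 1):
-- T ⋆ T splits into roots 2αᵢ and αᵢ + αⱼ = 1 − αₖ; T ⋆ 2ⁿT^{(2,3,10)} into roots 3αᵢ and
-- 2αᵢ + αⱼ; and T ⋆ v, for v with roots 1 − αᵢ such as 1 ⋆ (−1)ⁿT^{(−1,2,7)}, into the root 1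
-- and again 2αᵢ + αⱼ (i ≠ j).  No root is ever computed: each splitting is an identity
-- between families indexed by initial values, and both sides obey the Leibniz rule
-- (f ⋆ g)(n + 1) = (f′ ⋆ g)(n) + (f ⋆ g′)(n) and agree at n = 0.  Eliminating the common
-- sextic part between the last two splittings expresses 3ⁿT^{(3,3,5)} through the other
-- two sums, and the theorem is a rational linear combination of the resulting identities.
module Submission where

open import Defs
open import Data.Nat using (ℕ; zero; suc; _∸_; _≤_; z≤n; _!)
import Data.Nat as ℕ
import Data.Nat.Properties as ℕₚ
open import Data.Nat.Combinatorics
  using (_C_; nCk+nC[k+1]≡[n+1]C[k+1]; k>n⇒nCk≡0; nCk≡n!/k![n-k]!; k![n∸k]!∣n!)
open import Data.Nat.DivMod using (m/n*n≡m; m*n/n≡m; /-congˡ)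
import Data.Nat.Coprimality as Coprimality
import Data.Nat.Tactic.RingSolver as ℕ-Solver
open import Data.Fin using (_↑ˡ_; _↑ʳ_)
open import Data.Integer using (ℤ; +_; -_)
import Data.Integer as ℤ
import Data.Integer.Properties as ℤₚ
open import Data.Integer.Tactic.RingSolver using (solve-∀)
import Data.Integer.Solver as ℤ-Solver
open import Data.Product using (_×_; _,_)
open import Data.Vec using (Vec; []; _∷_; _∷ʳ_; _++_; head; map; zipWith; tabulate)
open import Data.Vec.Properties
  using (map-∷ʳ; ∷-injectiveˡ; ∷-injectiveʳ; tabulate-∘; tabulate-cong; tabulate∘lookup; lookup-++ˡ; lookup-++ʳ)
open import Data.Bool using (if_then_else_; _∧_)
open import Function using (_∘_)
import Algebra.Properties.CommutativeSemigroup as CommutativeSemigroupProperties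
open import Relation.Binary.PropositionalEquality
open ≡-Reasoning

module Poly = ℤ-Solver.+-*-Solver

module _ where
  open import Data.Integer using (_+_; _*_; _^_)
  open CommutativeSemigroupProperties ℤₚ.+-commutativeSemigroup using () renaming (interchange to +-interchange)

  -- Binomial convolution

  ∑ : ℕ → (ℕ → ℤ) → ℤ
  ∑ zero f = f 0
  ∑ (suc n) f = ∑ n f + f (suc n)

  ∑-cong : ∀ n {f g : ℕ → ℤ} → (∀ {k} → k ≤ n → f k ≡ g k) → ∑ n f ≡ ∑ n g
  ∑-cong zero f≗g = f≗g z≤n
  ∑-cong (suc n) f≗g = cong₂ _+_ (∑-cong n (f≗g ∘ ℕₚ.m≤n⇒m≤1+n)) (f≗g ℕₚ.≤-refl)

  ∑-+ : ∀ n (f g : ℕ → ℤ) → ∑ n (λ k → f k + g k) ≡ ∑ n f + ∑ n g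
  ∑-+ zero f g = refl
  ∑-+ (suc n) f g = begin
    ∑ n (λ k → f k + g k) + (f (suc n) + g (suc n))  ≡⟨ cong (_+ (f (suc n) + g (suc n))) (∑-+ n f g) ⟩
    (∑ n f + ∑ n g) + (f (suc n) + g (suc n))        ≡⟨ +-interchange (∑ n f) (∑ n g) (f (suc n)) (g (suc n)) ⟩
    ∑ n f + f (suc n) + (∑ n g + g (suc n))          ∎

  ∑-*ˡ : ∀ n a (f : ℕ → ℤ) → ∑ n (λ k → a * f k) ≡ a * ∑ n f
  ∑-*ˡ zero a f = refl
  ∑-*ˡ (suc n) a f = trans (cong (_+ a * f (suc n)) (∑-*ˡ n a f)) (sym (ℤₚ.*-distribˡ-+ a (∑ n f) (f (suc n))))

  ∑-suc : ∀ n (f : ℕ → ℤ) → ∑ (suc n) f ≡ f 0 + ∑ n (f ∘ suc)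
  ∑-suc zero f = refl
  ∑-suc (suc n) f = trans (cong (_+ f (suc (suc n))) (∑-suc n f)) (ℤₚ.+-assoc (f 0) _ _)

  infixl 7 _⋆_
  _⋆_ : (ℕ → ℤ) → (ℕ → ℤ) → ℕ → ℤ
  (f ⋆ g) n = ∑ n (λ k → + (n C k) * f k * g (n ∸ k))

  shift : (ℕ → ℤ) → ℕ → ℤ
  shift f = f ∘ suc

  ⋆-zero : ∀ f g → (f ⋆ g) 0 ≡ f 0 * g 0
  ⋆-zero f g = cong (_* g 0) (ℤₚ.*-identityˡ (f 0))

  ⋆-congˡ : ∀ {f f′ : ℕ → ℤ} g → (∀ k → f k ≡ f′ k) → ∀ n → (f ⋆ g) n ≡ (f′ ⋆ g) n
  ⋆-congˡ g f≗f′ n = ∑-cong n λ {k} _ → cong (λ x → + (n C k) * x * g (n ∸ k)) (f≗f′ k)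

  ⋆-congʳ : ∀ f {g g′ : ℕ → ℤ} → (∀ k → g k ≡ g′ k) → ∀ n → (f ⋆ g) n ≡ (f ⋆ g′) n
  ⋆-congʳ f g≗g′ n = ∑-cong n λ {k} _ → cong (+ (n C k) * f k *_) (g≗g′ (n ∸ k))

  ⋆-distribˡ-+ : ∀ (f g h : ℕ → ℤ) n → (f ⋆ (λ k → g k + h k)) n ≡ (f ⋆ g) n + (f ⋆ h) n
  ⋆-distribˡ-+ f g h n =
    trans (∑-cong n λ {k} _ → ℤₚ.*-distribˡ-+ (+ (n C k) * f k) (g (n ∸ k)) (h (n ∸ k))) (∑-+ n _ _)

  ⋆-distribʳ-+ : ∀ (f g h : ℕ → ℤ) n → ((λ k → f k + g k) ⋆ h) n ≡ (f ⋆ h) n + (g ⋆ h) n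
  ⋆-distribʳ-+ f g h n = trans (∑-cong n λ {k} _ → distrib (+ (n C k)) (f k) (g k) (h (n ∸ k))) (∑-+ n _ _)
    where
    distrib : ∀ c x y z → c * (x + y) * z ≡ c * x * z + c * y * z
    distrib = solve-∀

  ⋆-*ʳ : ∀ (f : ℕ → ℤ) a g n → (f ⋆ (λ k → a * g k)) n ≡ a * (f ⋆ g) n
  ⋆-*ʳ f a g n = trans (∑-cong n λ {k} _ → pull a (+ (n C k)) (f k) (g (n ∸ k))) (∑-*ˡ n a _)
    where
    pull : ∀ a c x y → c * x * (a * y) ≡ a * (c * x * y)
    pull = solve-∀

  ⋆-shift : ∀ f g n → (f ⋆ g) (suc n) ≡ (shift f ⋆ g) n + (f ⋆ shift g) n
  ⋆-shift f g n = begin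
    (f ⋆ g) (suc n)
      ≡⟨ ∑-suc n _ ⟩
    first n + ∑ n (λ k → + (suc n C suc k) * f (suc k) * g (n ∸ k))
      ≡⟨ cong (_+_ (first n)) (trans (∑-cong n λ {k} _ → pascal k) (∑-+ n _ _)) ⟩
    first n + ((shift f ⋆ g) n + rest n)
      ≡⟨ x+[y+z]≡y+[x+z] (first n) ((shift f ⋆ g) n) (rest n) ⟩
    (shift f ⋆ g) n + (first n + rest n)
      ≡⟨ cong (_+_ ((shift f ⋆ g) n)) (first+rest n) ⟩
    (shift f ⋆ g) n + (f ⋆ shift g) n ∎
    where
    first : ℕ → ℤ
    first m = + 1 * f 0 * g (suc m)

    term : ℕ → ℕ → ℤ
    term m k = + (m C suc k) * f (suc k) * g (m ∸ k)

    rest : ℕ → ℤ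
    rest m = ∑ m (term m)

    x+[y+z]≡y+[x+z] : ∀ x y z → x + (y + z) ≡ y + (x + z)
    x+[y+z]≡y+[x+z] = solve-∀

    distrib : ∀ a b x y → (a + b) * x * y ≡ a * x * y + b * x * y
    distrib = solve-∀

    pascal : ∀ k → + (suc n C suc k) * f (suc k) * g (n ∸ k)
                 ≡ + (n C k) * f (suc k) * g (n ∸ k) + term n k
    pascal k = begin
      + (suc n C suc k) * f (suc k) * g (n ∸ k)
        ≡⟨ cong (λ c → + c * f (suc k) * g (n ∸ k)) (sym (nCk+nC[k+1]≡[n+1]C[k+1] n k)) ⟩
      + (n C k ℕ.+ n C suc k) * f (suc k) * g (n ∸ k)
        ≡⟨ cong (λ c → c * f (suc k) * g (n ∸ k)) (ℤₚ.pos-+ (n C k) (n C suc k)) ⟩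
      (+ (n C k) + + (n C suc k)) * f (suc k) * g (n ∸ k)
        ≡⟨ distrib (+ (n C k)) (+ (n C suc k)) (f (suc k)) (g (n ∸ k)) ⟩
      + (n C k) * f (suc k) * g (n ∸ k) + term n k ∎

    drop-zero : ∀ r x y → r + + 0 * x * y ≡ r
    drop-zero = solve-∀

    first+rest : ∀ m → first m + rest m ≡ (f ⋆ shift g) m
    first+rest zero = drop-zero (first 0) (f 1) (g 0)
    first+rest (suc m) = begin
      first (suc m) + (∑ m (term (suc m)) + + (suc m C suc (suc m)) * f (suc (suc m)) * g (m ∸ m))
        ≡⟨ cong (λ c → first (suc m) + (∑ m (term (suc m)) + + c * f (suc (suc m)) * g (m ∸ m)))
                (k>n⇒nCk≡0 (ℕₚ.n<1+n (suc m))) ⟩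
      first (suc m) + (∑ m (term (suc m)) + + 0 * f (suc (suc m)) * g (m ∸ m))
        ≡⟨ cong (_+_ (first (suc m))) (drop-zero (∑ m (term (suc m))) (f (suc (suc m))) (g (m ∸ m))) ⟩
      first (suc m) + ∑ m (term (suc m))
        ≡⟨ cong (_+_ (first (suc m))) (∑-cong m λ {k} k≤m →
             cong (λ j → + (suc m C suc k) * f (suc k) * g j) (ℕₚ.+-∸-assoc 1 k≤m)) ⟩
      first (suc m) + ∑ m (λ k → + (suc m C suc k) * f (suc k) * g (suc (m ∸ k)))
        ≡⟨ sym (∑-suc m _) ⟩
      (f ⋆ shift g) (suc m) ∎

  module _ {X A : Set} (R : (X → A) → X → A)
           (R-cong : ∀ {u v} → (∀ x → u x ≡ v x) → ∀ x → R u x ≡ R v x) where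

    unique-by-recursion : (F G : ℕ → X → A) → (∀ x → F 0 x ≡ G 0 x) →
      (∀ n x → F (suc n) x ≡ R (F n) x) → (∀ n x → G (suc n) x ≡ R (G n) x) →
      ∀ n x → F n x ≡ G n x
    unique-by-recursion F G base F-rec G-rec zero x = base x
    unique-by-recursion F G base F-rec G-rec (suc n) x =
      trans (F-rec n x) (trans (R-cong (unique-by-recursion F G base F-rec G-rec n) x) (sym (G-rec n x)))

  ⋆-comm : ∀ f g n → (f ⋆ g) n ≡ (g ⋆ f) n
  ⋆-comm f g n = unique-by-recursion R R-cong F G base F-rec G-rec n (f , g)
    where
    R : ((ℕ → ℤ) × (ℕ → ℤ) → ℤ) → (ℕ → ℤ) × (ℕ → ℤ) → ℤ
    R u (f , g) = u (shift f , g) + u (f , shift g)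

    R-cong : ∀ {u v} → (∀ x → u x ≡ v x) → ∀ x → R u x ≡ R v x
    R-cong u≗v (f , g) = cong₂ _+_ (u≗v _) (u≗v _)

    F G : ℕ → (ℕ → ℤ) × (ℕ → ℤ) → ℤ
    F n (f , g) = (f ⋆ g) n
    G n (f , g) = (g ⋆ f) n

    base : ∀ x → F 0 x ≡ G 0 x
    base (f , g) = trans (⋆-zero f g) (trans (ℤₚ.*-comm (f 0) (g 0)) (sym (⋆-zero g f)))

    F-rec : ∀ n x → F (suc n) x ≡ R (F n) x
    F-rec n (f , g) = ⋆-shift f g n

    G-rec : ∀ n x → G (suc n) x ≡ R (G n) x
    G-rec n (f , g) = trans (⋆-shift g f n) (ℤₚ.+-comm ((shift g ⋆ f) n) ((g ⋆ shift f) n))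

  ⋆-assoc : ∀ f g h n → ((f ⋆ g) ⋆ h) n ≡ (f ⋆ (g ⋆ h)) n
  ⋆-assoc f g h n = unique-by-recursion R R-cong F G base F-rec G-rec n (f , g , h)
    where
    Triple = (ℕ → ℤ) × (ℕ → ℤ) × (ℕ → ℤ)

    R : (Triple → ℤ) → Triple → ℤ
    R u (f , g , h) = u (shift f , g , h) + u (f , shift g , h) + u (f , g , shift h)

    R-cong : ∀ {u v} → (∀ x → u x ≡ v x) → ∀ x → R u x ≡ R v x
    R-cong u≗v (f , g , h) = cong₂ _+_ (cong₂ _+_ (u≗v _) (u≗v _)) (u≗v _)

    F G : ℕ → Triple → ℤ
    F n (f , g , h) = ((f ⋆ g) ⋆ h) n
    G n (f , g , h) = (f ⋆ (g ⋆ h)) n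

    base : ∀ x → F 0 x ≡ G 0 x
    base (f , g , h) = begin
      ((f ⋆ g) ⋆ h) 0   ≡⟨ ⋆-zero (f ⋆ g) h ⟩
      (f ⋆ g) 0 * h 0   ≡⟨ cong (_* h 0) (⋆-zero f g) ⟩
      f 0 * g 0 * h 0   ≡⟨ ℤₚ.*-assoc (f 0) (g 0) (h 0) ⟩
      f 0 * (g 0 * h 0) ≡⟨ cong (f 0 *_) (sym (⋆-zero g h)) ⟩
      f 0 * (g ⋆ h) 0   ≡⟨ sym (⋆-zero f (g ⋆ h)) ⟩
      (f ⋆ (g ⋆ h)) 0   ∎

    F-rec : ∀ n x → F (suc n) x ≡ R (F n) x
    F-rec n (f , g , h) = begin
      ((f ⋆ g) ⋆ h) (suc n)
        ≡⟨ ⋆-shift (f ⋆ g) h n ⟩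
      (shift (f ⋆ g) ⋆ h) n + ((f ⋆ g) ⋆ shift h) n
        ≡⟨ cong (_+ ((f ⋆ g) ⋆ shift h) n) (⋆-congˡ h (⋆-shift f g) n) ⟩
      ((λ k → (shift f ⋆ g) k + (f ⋆ shift g) k) ⋆ h) n + ((f ⋆ g) ⋆ shift h) n
        ≡⟨ cong (_+ ((f ⋆ g) ⋆ shift h) n) (⋆-distribʳ-+ (shift f ⋆ g) (f ⋆ shift g) h n) ⟩
      R (F n) (f , g , h) ∎

    G-rec : ∀ n x → G (suc n) x ≡ R (G n) x
    G-rec n (f , g , h) = begin
      (f ⋆ (g ⋆ h)) (suc n)
        ≡⟨ ⋆-shift f (g ⋆ h) n ⟩
      (shift f ⋆ (g ⋆ h)) n + (f ⋆ shift (g ⋆ h)) n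
        ≡⟨ cong (_+_ ((shift f ⋆ (g ⋆ h)) n)) (⋆-congʳ f (⋆-shift g h) n) ⟩
      (shift f ⋆ (g ⋆ h)) n + (f ⋆ (λ k → (shift g ⋆ h) k + (g ⋆ shift h) k)) n
        ≡⟨ cong (_+_ ((shift f ⋆ (g ⋆ h)) n)) (⋆-distribˡ-+ f (shift g ⋆ h) (g ⋆ shift h) n) ⟩
      (shift f ⋆ (g ⋆ h)) n + ((f ⋆ (shift g ⋆ h)) n + (f ⋆ (g ⋆ shift h)) n)
        ≡⟨ sym (ℤₚ.+-assoc ((shift f ⋆ (g ⋆ h)) n) _ _) ⟩
      R (G n) (f , g , h) ∎

  -- Linear recurrences

  -- Generic in the ring operations, so that the same definitions also act on symbolic polynomials.
  module VectorOps {A : Set} (_+′_ _*′_ : A → A → A) (0′ : A) where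

    infix 8 _∙_
    _∙_ : ∀ {d} → Vec A d → Vec A d → A
    [] ∙ [] = 0′
    (c ∷ cs) ∙ (x ∷ xs) = (c *′ x) +′ (cs ∙ xs)

    infixl 6 _⊕_
    _⊕_ : ∀ {d} → Vec A d → Vec A d → Vec A d
    _⊕_ = zipWith _+′_

    -- seq c s (defined below) solves u (n + d + 1) = c ∙ (u n , … , u (n + d)) with initial
    -- values s; step c moves the window of d + 1 consecutive values one place on.
    step : ∀ {d} → Vec A (suc d) → Vec A (suc d) → Vec A (suc d)
    step c (x ∷ xs) = xs ∷ʳ c ∙ (x ∷ xs)

    ⟦_⟧ : ∀ {d e f} → Vec (Vec (Vec A e) d) f → Vec A d → Vec A e → Vec A f
    ⟦ M ⟧ s t = map (λ B → s ∙ map (_∙ t) B) M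

  Bilinear : ℕ → ℕ → ℕ → Set
  Bilinear d e f = Vec (Vec (Vec ℤ e) d) f

  open VectorOps _+_ _*_ (+ 0)

  infixr 7 _⊙_
  _⊙_ : ∀ {d} → ℤ → Vec ℤ d → Vec ℤ d
  k ⊙ s = map (k *_) s

  ∙-distribˡ-⊕ : ∀ {d} (c s t : Vec ℤ d) → c ∙ (s ⊕ t) ≡ c ∙ s + c ∙ t
  ∙-distribˡ-⊕ [] [] [] = refl
  ∙-distribˡ-⊕ (c ∷ cs) (x ∷ xs) (y ∷ ys) =
    trans (cong (_+_ (c * (x + y))) (∙-distribˡ-⊕ cs xs ys)) (shuffle c x y (cs ∙ xs) (cs ∙ ys))
    where
    shuffle : ∀ c x y a b → c * (x + y) + (a + b) ≡ c * x + a + (c * y + b)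
    shuffle = solve-∀

  ∙-⊙ : ∀ {d} (c : Vec ℤ d) k s → c ∙ (k ⊙ s) ≡ k * c ∙ s
  ∙-⊙ [] k [] = sym (ℤₚ.*-zeroʳ k)
  ∙-⊙ (c ∷ cs) k (x ∷ xs) = trans (cong (_+_ (c * (k * x))) (∙-⊙ cs k xs)) (shuffle c k x (cs ∙ xs))
    where
    shuffle : ∀ c k x a → c * (k * x) + k * a ≡ k * (c * x + a)
    shuffle = solve-∀

  ⊕-∷ʳ : ∀ {d} (xs ys : Vec ℤ d) x y → (xs ∷ʳ x) ⊕ (ys ∷ʳ y) ≡ (xs ⊕ ys) ∷ʳ (x + y)
  ⊕-∷ʳ [] [] x y = refl
  ⊕-∷ʳ (x′ ∷ xs) (y′ ∷ ys) x y = cong (x′ + y′ ∷_) (⊕-∷ʳ xs ys x y)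

  seq : ∀ {d} → Vec ℤ (suc d) → Vec ℤ (suc d) → ℕ → ℤ
  seq c s zero = head s
  seq c s (suc n) = seq c (step c s) n

  module _ {d} (c : Vec ℤ (suc d)) where

    step-⊕ : ∀ s t → step c (s ⊕ t) ≡ step c s ⊕ step c t
    step-⊕ (x ∷ xs) (y ∷ ys) = begin
      (xs ⊕ ys) ∷ʳ c ∙ ((x ∷ xs) ⊕ (y ∷ ys))      ≡⟨ cong ((xs ⊕ ys) ∷ʳ_) (∙-distribˡ-⊕ c (x ∷ xs) (y ∷ ys)) ⟩
      (xs ⊕ ys) ∷ʳ (c ∙ (x ∷ xs) + c ∙ (y ∷ ys)) ≡⟨ sym (⊕-∷ʳ xs ys _ _) ⟩
      step c (x ∷ xs) ⊕ step c (y ∷ ys)          ∎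

    step-⊙ : ∀ k s → step c (k ⊙ s) ≡ k ⊙ step c s
    step-⊙ k (x ∷ xs) = trans (cong (k ⊙ xs ∷ʳ_) (∙-⊙ c k (x ∷ xs))) (sym (map-∷ʳ (k *_) _ xs))

    seq-⊕ : ∀ n s t → seq c (s ⊕ t) n ≡ seq c s n + seq c t n
    seq-⊕ zero (x ∷ xs) (y ∷ ys) = refl
    seq-⊕ (suc n) s t = trans (cong (λ u → seq c u n) (step-⊕ s t)) (seq-⊕ n (step c s) (step c t))

    seq-⊙ : ∀ n k s → seq c (k ⊙ s) n ≡ k * seq c s n
    seq-⊙ zero k (x ∷ xs) = refl
    seq-⊙ (suc n) k s = trans (cong (λ u → seq c u n) (step-⊙ k s)) (seq-⊙ n k (step c s))

  constant : Vec ℤ 1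
  constant = + 1 ∷ []

  seq-constant : ∀ x n → seq constant (x ∷ []) n ≡ x
  seq-constant x zero = refl
  seq-constant x (suc n) = trans (seq-constant (+ 1 * x + + 0) n) (unit x)
    where
    unit : ∀ x → + 1 * x + + 0 ≡ x
    unit = solve-∀

  window : (ℕ → ℤ) → ℕ → Vec ℤ 3
  window h n = h n ∷ h (suc n) ∷ h (suc (suc n)) ∷ []

  Solves : Vec ℤ 3 → (ℕ → ℤ) → Set
  Solves c h = ∀ n → h (3 ℕ.+ n) ≡ c ∙ window h n

  Solves⇒≡seq : ∀ c h → Solves c h → ∀ n → h n ≡ seq c (window h 0) n
  Solves⇒≡seq c h solves n = from n 0
    where
    from : ∀ n k → h (k ℕ.+ n) ≡ seq c (window h k) n
    from zero k = cong h (ℕₚ.+-identityʳ k)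
    from (suc n) k = begin
      h (k ℕ.+ suc n)                ≡⟨ cong h (ℕₚ.+-suc k n) ⟩
      h (suc k ℕ.+ n)                ≡⟨ from n (suc k) ⟩
      seq c (window h (suc k)) n     ≡⟨ cong (λ z → seq c (h (suc k) ∷ h (2 ℕ.+ k) ∷ z ∷ []) n) (solves k) ⟩
      seq c (step c (window h k)) n  ∎

  tribonacci : Vec ℤ 3
  tribonacci = + 1 ∷ + 1 ∷ + 1 ∷ []

  -- the recurrence whose characteristic roots are l times those of c
  dilate : ℤ → Vec ℤ 3 → Vec ℤ 3
  dilate l (c₀ ∷ c₁ ∷ c₂ ∷ []) = l * l * l * c₀ ∷ l * l * c₁ ∷ l * c₂ ∷ []

  Trib-solves : ∀ s₀ s₁ s₂ → Solves tribonacci (Trib s₀ s₁ s₂)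
  Trib-solves s₀ s₁ s₂ n = sum≡∙ (Trib s₀ s₁ s₂ n) (Trib s₀ s₁ s₂ (suc n)) (Trib s₀ s₁ s₂ (suc (suc n)))
    where
    sum≡∙ : ∀ x y z → z + y + x ≡ + 1 * x + (+ 1 * y + (+ 1 * z + + 0))
    sum≡∙ = solve-∀

  dilate-solves : ∀ l c h → Solves c h → Solves (dilate l c) (λ n → l ^ n * h n)
  dilate-solves l (c₀ ∷ c₁ ∷ c₂ ∷ []) h solves n =
    trans (cong (l ^ (3 ℕ.+ n) *_) (solves n)) (scale l (l ^ n) c₀ c₁ c₂ (h n) (h (suc n)) (h (suc (suc n))))
    where
    scale : ∀ l p c₀ c₁ c₂ x y z →
      l * (l * (l * p)) * (c₀ * x + (c₁ * y + (c₂ * z + + 0)))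
      ≡ l * l * l * c₀ * (p * x) + (l * l * c₁ * (l * p * y) + (l * c₂ * (l * (l * p) * z) + + 0))
    scale = solve-∀

  dilated-Trib≡seq : ∀ l s₀ s₁ s₂ n → l ^ n * Trib s₀ s₁ s₂ n
                     ≡ seq (dilate l tribonacci) (window (λ k → l ^ k * Trib s₀ s₁ s₂ k) 0) n
  dilated-Trib≡seq l s₀ s₁ s₂ =
    Solves⇒≡seq _ _ (dilate-solves l tribonacci (Trib s₀ s₁ s₂) (Trib-solves s₀ s₁ s₂))

  -- Identities between bilinear maps, by normalisation

  module Symbolic (n : ℕ) = VectorOps {Poly.Polynomial n} Poly._:+_ Poly._:*_ (Poly.con (+ 0))

  constants : ∀ {n k} → Vec ℤ k → Vec (Poly.Polynomial n) k
  constants = map Poly.con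

  symbolic : ∀ {n d e f} → Bilinear d e f → Vec (Vec (Vec (Poly.Polynomial n) e) d) f
  symbolic = map (map constants)

  head-map : ∀ {A B : Set} {k} (f : A → B) (v : Vec A (suc k)) → head (map f v) ≡ f (head v)
  head-map f (x ∷ v) = refl

  module Evaluation {n} (ρ : Vec ℤ n) where
    private
      module S = Symbolic n

    ev : Poly.Polynomial n → ℤ
    ev p = Poly.⟦ p ⟧ ρ

    ev-normal : ∀ {k} (u v : Vec (Poly.Polynomial n) k) →
                map Poly.normalise u ≡ map Poly.normalise v → map ev u ≡ map ev v
    ev-normal [] [] _ = refl
    ev-normal (x ∷ u) (y ∷ v) u↓≡v↓ =
      cong₂ _∷_ (Poly.prove ρ x y (cong (λ p → Poly.⟦ p ⟧N ρ) (∷-injectiveˡ u↓≡v↓)))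
                (ev-normal u v (∷-injectiveʳ u↓≡v↓))

    ev-con : ∀ {k} (c : Vec ℤ k) → map ev (constants c) ≡ c
    ev-con [] = refl
    ev-con (x ∷ c) = cong (x ∷_) (ev-con c)

    ev-symbolic : ∀ {d e f} (M : Bilinear d e f) → map (map (map ev)) (symbolic M) ≡ M
    ev-symbolic [] = refl
    ev-symbolic (B ∷ M) = cong₂ _∷_ (rows B) (ev-symbolic M)
      where
      rows : ∀ {d e} (B : Vec (Vec ℤ e) d) → map (map ev) (map constants B) ≡ B
      rows [] = refl
      rows (r ∷ B) = cong₂ _∷_ (ev-con r) (rows B)

    ev-∙ : ∀ {k} (u v : Vec (Poly.Polynomial n) k) → ev (u S.∙ v) ≡ map ev u ∙ map ev v
    ev-∙ [] [] = refl
    ev-∙ (x ∷ u) (y ∷ v) = cong (_+_ (ev x * ev y)) (ev-∙ u v)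

    ev-⊕ : ∀ {k} (u v : Vec (Poly.Polynomial n) k) → map ev (u S.⊕ v) ≡ map ev u ⊕ map ev v
    ev-⊕ [] [] = refl
    ev-⊕ (x ∷ u) (y ∷ v) = cong (ev x + ev y ∷_) (ev-⊕ u v)

    ev-step : ∀ {k} (c : Vec ℤ (suc k)) {x s} → map ev x ≡ s → map ev (S.step (constants c) x) ≡ step c s
    ev-step c {x₀ ∷ x} refl =
      trans (map-∷ʳ ev _ x) (cong (map ev x ∷ʳ_) (trans (ev-∙ (constants c) (x₀ ∷ x))
                                                         (cong (_∙ map ev (x₀ ∷ x)) (ev-con c))))

    ev-⟦⟧ : ∀ {d e f} (M : Bilinear d e f) {x y s t} → map ev x ≡ s → map ev y ≡ t →
            map ev (S.⟦ symbolic M ⟧ x y) ≡ ⟦ M ⟧ s t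
    ev-⟦⟧ M {x} {y} refl refl = trans (raw (symbolic M)) (cong (λ N → ⟦ N ⟧ (map ev x) (map ev y)) (ev-symbolic M))
      where
      rows : ∀ {d} (B : Vec (Vec (Poly.Polynomial n) _) d) → map ev (map (S._∙ y) B) ≡ map (_∙ map ev y) (map (map ev) B)
      rows [] = refl
      rows (r ∷ B) = cong₂ _∷_ (ev-∙ r y) (rows B)
      raw : ∀ {f} (N : Vec (Vec (Vec (Poly.Polynomial n) _) _) f) →
            map ev (S.⟦ N ⟧ x y) ≡ ⟦ map (map (map ev)) N ⟧ (map ev x) (map ev y)
      raw [] = refl
      raw (B ∷ N) = cong₂ _∷_ (trans (ev-∙ x (map (S._∙ y) B)) (cong (map ev x ∙_) (rows B))) (raw N)

  -- An identity between bilinear expressions in s and t holds as soon as it holds for the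
  -- symbolic variables x̂ and ŷ, where it is decided by comparing ring normal forms.
  module BilinearIdentities {d e : ℕ} where
    private
      n = suc d ℕ.+ suc e
      module S = Symbolic n

    x̂ : Vec (Poly.Polynomial n) (suc d)
    x̂ = tabulate (λ i → Poly.var (i ↑ˡ suc e))

    ŷ : Vec (Poly.Polynomial n) (suc e)
    ŷ = tabulate (λ j → Poly.var (suc d ↑ʳ j))

    corner : ℤ → Poly.Polynomial n
    corner k = Poly.con k Poly.:* (head x̂ Poly.:* head ŷ)

    first : ∀ {f} → Bilinear (suc d) (suc e) (suc f) → Poly.Polynomial n
    first M = head (S.⟦ symbolic M ⟧ x̂ ŷ)

    module At (s : Vec ℤ (suc d)) (t : Vec ℤ (suc e)) where
      open Evaluation (s ++ t) public

      ev-x̂ : map ev x̂ ≡ s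
      ev-x̂ = trans (sym (tabulate-∘ ev (Poly.var ∘ (_↑ˡ suc e))))
                   (trans (tabulate-cong (lookup-++ˡ s t)) (tabulate∘lookup s))

      ev-ŷ : map ev ŷ ≡ t
      ev-ŷ = trans (sym (tabulate-∘ ev (Poly.var ∘ (suc d ↑ʳ_))))
                   (trans (tabulate-cong (lookup-++ʳ s t)) (tabulate∘lookup t))

      ev-corner : ∀ k → k * (head s * head t) ≡ ev (corner k)
      ev-corner k = sym (cong₂ (λ x y → k * (x * y)) (cong head ev-x̂) (cong head ev-ŷ))

      ev-first : ∀ {f} (M : Bilinear (suc d) (suc e) (suc f)) → ev (first M) ≡ head (⟦ M ⟧ s t)
      ev-first M = trans (sym (head-map ev (S.⟦ symbolic M ⟧ x̂ ŷ))) (cong head (ev-⟦⟧ M ev-x̂ ev-ŷ))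

    infix 4 _≃_
    _≃_ : ∀ {k} → Vec (Poly.Polynomial n) k → Vec (Poly.Polynomial n) k → Set
    u ≃ v = map Poly.normalise u ≡ map Poly.normalise v

    bilinear-law : ∀ {f} (a : Vec ℤ (suc d)) (b : Vec ℤ (suc e)) (c : Vec ℤ (suc f)) M →
      S.⟦ symbolic M ⟧ (S.step (constants a) x̂) ŷ S.⊕ S.⟦ symbolic M ⟧ x̂ (S.step (constants b) ŷ)
        ≃ S.step (constants c) (S.⟦ symbolic M ⟧ x̂ ŷ) →
      ∀ s t → ⟦ M ⟧ (step a s) t ⊕ ⟦ M ⟧ s (step b t) ≡ step c (⟦ M ⟧ s t)
    bilinear-law a b c M normal-forms s t = begin
      ⟦ M ⟧ (step a s) t ⊕ ⟦ M ⟧ s (step b t)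
        ≡⟨ sym (trans (ev-⊕ _ _) (cong₂ _⊕_ (ev-⟦⟧ M (ev-step a ev-x̂) ev-ŷ) (ev-⟦⟧ M ev-x̂ (ev-step b ev-ŷ)))) ⟩
      map ev (S.⟦ symbolic M ⟧ (S.step (constants a) x̂) ŷ S.⊕ S.⟦ symbolic M ⟧ x̂ (S.step (constants b) ŷ))
        ≡⟨ ev-normal _ _ normal-forms ⟩
      map ev (S.step (constants c) (S.⟦ symbolic M ⟧ x̂ ŷ))
        ≡⟨ ev-step c (ev-⟦⟧ M ev-x̂ ev-ŷ) ⟩
      step c (⟦ M ⟧ s t) ∎
      where open At s t

    bilinear-base₁ : ∀ {f} k (M : Bilinear (suc d) (suc e) (suc f)) → corner k ∷ [] ≃ first M ∷ [] →
      ∀ s t → k * (head s * head t) ≡ head (⟦ M ⟧ s t)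
    bilinear-base₁ k M normal-forms s t = begin
      k * (head s * head t)  ≡⟨ ev-corner k ⟩
      ev (corner k)          ≡⟨ cong head (ev-normal (corner k ∷ []) (first M ∷ []) normal-forms) ⟩
      ev (first M)           ≡⟨ ev-first M ⟩
      head (⟦ M ⟧ s t)       ∎
      where open At s t

    bilinear-base₂ : ∀ {f f′} k (M : Bilinear (suc d) (suc e) (suc f)) (M′ : Bilinear (suc d) (suc e) (suc f′)) →
      corner k ∷ [] ≃ first M Poly.:+ first M′ ∷ [] →
      ∀ s t → k * (head s * head t) ≡ head (⟦ M ⟧ s t) + head (⟦ M′ ⟧ s t)
    bilinear-base₂ k M M′ normal-forms s t = begin
      k * (head s * head t)                 ≡⟨ ev-corner k ⟩
      ev (corner k)                         ≡⟨ cong head (ev-normal (corner k ∷ []) (first M Poly.:+ first M′ ∷ []) normal-forms) ⟩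
      ev (first M) + ev (first M′)          ≡⟨ cong₂ _+_ (ev-first M) (ev-first M′) ⟩
      head (⟦ M ⟧ s t) + head (⟦ M′ ⟧ s t)  ∎
      where open At s t

  -- Splitting convolutions of recurrence sequences

  module Splitting {d e} (a : Vec ℤ (suc d)) (b : Vec ℤ (suc e)) where

    Family : Set
    Family = ℕ → Vec ℤ (suc d) → Vec ℤ (suc e) → ℤ

    Leibniz : Family → Set
    Leibniz G = ∀ n s t → G (suc n) s t ≡ G n (step a s) t + G n s (step b t)

    Leibniz-unique : ∀ {G H} → Leibniz G → Leibniz H → (∀ s t → G 0 s t ≡ H 0 s t) →
                     ∀ n s t → G n s t ≡ H n s t
    Leibniz-unique {G} {H} G-rec H-rec base n s t =
      unique-by-recursion R R-cong (λ n (s , t) → G n s t) (λ n (s , t) → H n s t)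
        (λ (s , t) → base s t) (λ n (s , t) → G-rec n s t) (λ n (s , t) → H-rec n s t) n (s , t)
      where
      R : (Vec ℤ (suc d) × Vec ℤ (suc e) → ℤ) → Vec ℤ (suc d) × Vec ℤ (suc e) → ℤ
      R u (s , t) = u (step a s , t) + u (s , step b t)

      R-cong : ∀ {u v} → (∀ x → u x ≡ v x) → ∀ x → R u x ≡ R v x
      R-cong u≗v (s , t) = cong₂ _+_ (u≗v _) (u≗v _)

    ⋆-Leibniz : ∀ k → Leibniz (λ n s t → k * (seq a s ⋆ seq b t) n)
    ⋆-Leibniz k n s t =
      trans (cong (k *_) (⋆-shift (seq a s) (seq b t) n)) (ℤₚ.*-distribˡ-+ k _ _)

    seqFamily : ∀ {f} → Vec ℤ (suc f) → (Vec ℤ (suc d) → Vec ℤ (suc e) → Vec ℤ (suc f)) → Family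
    seqFamily c M n s t = seq c (M s t) n

    seq-Leibniz : ∀ {f} (c : Vec ℤ (suc f)) M →
                  (∀ s t → M (step a s) t ⊕ M s (step b t) ≡ step c (M s t)) → Leibniz (seqFamily c M)
    seq-Leibniz c M law n s t =
      trans (cong (λ u → seq c u n) (sym (law s t))) (seq-⊕ c n (M (step a s) t) (M s (step b t)))

    Leibniz-+ : ∀ G H → Leibniz G → Leibniz H → Leibniz (λ n s t → G n s t + H n s t)
    Leibniz-+ G H G-rec H-rec n s t =
      trans (cong₂ _+_ (G-rec n s t) (H-rec n s t))
            (+-interchange (G n (step a s) t) (G n s (step b t)) (H n (step a s) t) (H n s (step b t)))

    ⋆-split₁ : ∀ k {f} (c : Vec ℤ (suc f)) M →
      (∀ s t → M (step a s) t ⊕ M s (step b t) ≡ step c (M s t)) →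
      (∀ s t → k * (head s * head t) ≡ head (M s t)) →
      ∀ n s t → k * (seq a s ⋆ seq b t) n ≡ seq c (M s t) n
    ⋆-split₁ k c M law base = Leibniz-unique (⋆-Leibniz k) (seq-Leibniz c M law)
      λ s t → trans (cong (k *_) (⋆-zero (seq a s) (seq b t))) (base s t)

    ⋆-split₂ : ∀ k {f f′} (c : Vec ℤ (suc f)) M (c′ : Vec ℤ (suc f′)) M′ →
      (∀ s t → M (step a s) t ⊕ M s (step b t) ≡ step c (M s t)) →
      (∀ s t → M′ (step a s) t ⊕ M′ s (step b t) ≡ step c′ (M′ s t)) →
      (∀ s t → k * (head s * head t) ≡ head (M s t) + head (M′ s t)) →
      ∀ n s t → k * (seq a s ⋆ seq b t) n ≡ seq c (M s t) n + seq c′ (M′ s t) n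
    ⋆-split₂ k c M c′ M′ law law′ base =
      Leibniz-unique (⋆-Leibniz k)
        (Leibniz-+ (seqFamily c M) (seqFamily c′ M′) (seq-Leibniz c M law) (seq-Leibniz c′ M′ law′))
        λ s t → trans (cong (k *_) (⋆-zero (seq a s) (seq b t))) (base s t)

  -- characteristic roots αⱼ + αₖ = 1 − αᵢ (j ≠ k), for the Tribonacci roots αᵢ
  pairSum : Vec ℤ 3
  pairSum = - + 2 ∷ + 0 ∷ + 2 ∷ []

  -- characteristic roots 2αᵢ + αⱼ (i ≠ j)
  sextic : Vec ℤ 6
  sextic = - + 53 ∷ + 6 ∷ + 17 ∷ - + 12 ∷ - + 7 ∷ + 6 ∷ []

  -- Each table below is the unique bilinear map satisfying its law and the base identity
  -- of the splitting in which it occurs; it was found by solving that linear system.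
  σ : Bilinear 3 3 3
  σ = ((+ 8 ∷ - + 5 ∷ + 1 ∷ []) ∷ (- + 5 ∷ - + 12 ∷ + 9 ∷ []) ∷ (+ 1 ∷ + 9 ∷ - + 4 ∷ []) ∷ []) ∷
      ((+ 2 ∷ + 18 ∷ - + 8 ∷ []) ∷ (+ 18 ∷ + 8 ∷ - + 6 ∷ []) ∷ (- + 8 ∷ - + 6 ∷ + 10 ∷ []) ∷ []) ∷
      ((- + 16 ∷ - + 12 ∷ + 20 ∷ []) ∷ (- + 12 ∷ + 24 ∷ + 4 ∷ []) ∷ (+ 20 ∷ + 4 ∷ + 8 ∷ []) ∷ []) ∷ []

  τ : Bilinear 3 3 3
  τ = ((+ 14 ∷ + 5 ∷ - + 1 ∷ []) ∷ (+ 5 ∷ + 12 ∷ - + 9 ∷ []) ∷ (- + 1 ∷ - + 9 ∷ + 4 ∷ []) ∷ []) ∷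
      ((- + 2 ∷ + 4 ∷ + 8 ∷ []) ∷ (+ 4 ∷ - + 8 ∷ + 6 ∷ []) ∷ (+ 8 ∷ + 6 ∷ - + 10 ∷ []) ∷ []) ∷
      ((+ 16 ∷ + 12 ∷ + 2 ∷ []) ∷ (+ 12 ∷ + 20 ∷ - + 4 ∷ []) ∷ (+ 2 ∷ - + 4 ∷ - + 8 ∷ []) ∷ []) ∷ []

  φ : Bilinear 3 3 3
  φ = ((+ 32 ∷ - + 10 ∷ + 1 ∷ []) ∷ (- + 20 ∷ - + 24 ∷ + 9 ∷ []) ∷ (+ 4 ∷ + 18 ∷ - + 4 ∷ []) ∷ []) ∷
      ((+ 12 ∷ + 54 ∷ - + 12 ∷ []) ∷ (+ 108 ∷ + 24 ∷ - + 9 ∷ []) ∷ (- + 48 ∷ - + 18 ∷ + 15 ∷ []) ∷ []) ∷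
      ((- + 144 ∷ - + 54 ∷ + 45 ∷ []) ∷ (- + 108 ∷ + 108 ∷ + 9 ∷ []) ∷ (+ 180 ∷ + 18 ∷ + 18 ∷ []) ∷ []) ∷ []

  ω : Bilinear 3 3 6
  ω = ((+ 56 ∷ + 10 ∷ - + 1 ∷ []) ∷ (+ 20 ∷ + 24 ∷ - + 9 ∷ []) ∷ (- + 4 ∷ - + 18 ∷ + 4 ∷ []) ∷ []) ∷
      ((- + 12 ∷ + 34 ∷ + 12 ∷ []) ∷ (- + 20 ∷ - + 24 ∷ + 9 ∷ []) ∷ (+ 48 ∷ + 18 ∷ - + 15 ∷ []) ∷ []) ∷
      ((+ 144 ∷ + 54 ∷ + 43 ∷ []) ∷ (+ 108 ∷ + 68 ∷ - + 9 ∷ []) ∷ (- + 92 ∷ - + 18 ∷ - + 18 ∷ []) ∷ []) ∷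
      ((+ 252 ∷ + 298 ∷ + 122 ∷ []) ∷ (- + 20 ∷ + 108 ∷ + 75 ∷ []) ∷ (- + 128 ∷ - + 114 ∷ - + 81 ∷ []) ∷ []) ∷
      ((+ 848 ∷ + 626 ∷ + 461 ∷ []) ∷ (+ 724 ∷ + 464 ∷ + 299 ∷ []) ∷ (- + 796 ∷ - + 458 ∷ - + 282 ∷ []) ∷ []) ∷
      ((+ 2892 ∷ + 2234 ∷ + 1266 ∷ []) ∷ (+ 2444 ∷ + 2088 ∷ + 1241 ∷ []) ∷ (- + 2328 ∷ - + 1918 ∷ - + 1005 ∷ []) ∷ []) ∷ []

  κ : Bilinear 3 3 1
  κ = ((+ 4 ∷ + 3 ∷ + 1 ∷ []) ∷ (- + 8 ∷ - + 6 ∷ + 9 ∷ []) ∷ (+ 6 ∷ - + 1 ∷ - + 4 ∷ []) ∷ []) ∷ []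

  χ : Bilinear 3 3 6
  χ = ((+ 18 ∷ - + 3 ∷ - + 1 ∷ []) ∷ (+ 8 ∷ + 6 ∷ - + 9 ∷ []) ∷ (- + 6 ∷ + 1 ∷ + 4 ∷ []) ∷ []) ∷
      ((- + 4 ∷ + 19 ∷ - + 1 ∷ []) ∷ (+ 30 ∷ + 6 ∷ - + 9 ∷ []) ∷ (- + 6 ∷ + 1 ∷ + 4 ∷ []) ∷ []) ∷
      ((- + 4 ∷ - + 3 ∷ + 21 ∷ []) ∷ (+ 8 ∷ + 50 ∷ - + 9 ∷ []) ∷ (+ 16 ∷ + 1 ∷ + 4 ∷ []) ∷ []) ∷
      ((- + 26 ∷ - + 3 ∷ + 43 ∷ []) ∷ (+ 30 ∷ + 6 ∷ + 57 ∷ []) ∷ (+ 16 ∷ + 67 ∷ + 4 ∷ []) ∷ []) ∷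
      ((- + 70 ∷ + 41 ∷ + 87 ∷ []) ∷ (- + 124 ∷ + 94 ∷ + 167 ∷ []) ∷ (+ 38 ∷ + 89 ∷ + 136 ∷ []) ∷ []) ∷
      ((- + 136 ∷ + 19 ∷ + 351 ∷ []) ∷ (- + 366 ∷ + 6 ∷ + 651 ∷ []) ∷ (- + 358 ∷ + 221 ∷ + 664 ∷ []) ∷ []) ∷ []

  ψ : Bilinear 1 3 3
  ψ = ((+ 1 ∷ + 0 ∷ + 0 ∷ []) ∷ []) ∷
      ((+ 1 ∷ + 1 ∷ + 0 ∷ []) ∷ []) ∷
      ((+ 1 ∷ + 2 ∷ + 1 ∷ []) ∷ []) ∷ []

  open BilinearIdentities using (bilinear-law; bilinear-base₁; bilinear-base₂)

  σ-law : ∀ s t → ⟦ σ ⟧ (step tribonacci s) t ⊕ ⟦ σ ⟧ s (step tribonacci t) ≡ step (dilate (+ 2) tribonacci) (⟦ σ ⟧ s t)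
  σ-law = bilinear-law tribonacci tribonacci (dilate (+ 2) tribonacci) σ refl

  τ-law : ∀ s t → ⟦ τ ⟧ (step tribonacci s) t ⊕ ⟦ τ ⟧ s (step tribonacci t) ≡ step pairSum (⟦ τ ⟧ s t)
  τ-law = bilinear-law tribonacci tribonacci pairSum τ refl

  φ-law : ∀ s t → ⟦ φ ⟧ (step tribonacci s) t ⊕ ⟦ φ ⟧ s (step (dilate (+ 2) tribonacci) t)
                  ≡ step (dilate (+ 3) tribonacci) (⟦ φ ⟧ s t)
  φ-law = bilinear-law tribonacci (dilate (+ 2) tribonacci) (dilate (+ 3) tribonacci) φ refl

  ω-law : ∀ s t → ⟦ ω ⟧ (step tribonacci s) t ⊕ ⟦ ω ⟧ s (step (dilate (+ 2) tribonacci) t) ≡ step sextic (⟦ ω ⟧ s t)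
  ω-law = bilinear-law tribonacci (dilate (+ 2) tribonacci) sextic ω refl

  κ-law : ∀ s t → ⟦ κ ⟧ (step tribonacci s) t ⊕ ⟦ κ ⟧ s (step pairSum t) ≡ step constant (⟦ κ ⟧ s t)
  κ-law = bilinear-law tribonacci pairSum constant κ refl

  χ-law : ∀ s t → ⟦ χ ⟧ (step tribonacci s) t ⊕ ⟦ χ ⟧ s (step pairSum t) ≡ step sextic (⟦ χ ⟧ s t)
  χ-law = bilinear-law tribonacci pairSum sextic χ refl

  ψ-law : ∀ s t → ⟦ ψ ⟧ (step constant s) t ⊕ ⟦ ψ ⟧ s (step (dilate (- + 1) tribonacci) t) ≡ step pairSum (⟦ ψ ⟧ s t)
  ψ-law = bilinear-law constant (dilate (- + 1) tribonacci) pairSum ψ refl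

  tribonacci⋆tribonacci : ∀ n s t → + 22 * (seq tribonacci s ⋆ seq tribonacci t) n
    ≡ seq (dilate (+ 2) tribonacci) (⟦ σ ⟧ s t) n + seq pairSum (⟦ τ ⟧ s t) n
  tribonacci⋆tribonacci = Splitting.⋆-split₂ tribonacci tribonacci (+ 22) _ ⟦ σ ⟧ _ ⟦ τ ⟧ σ-law τ-law
    (bilinear-base₂ (+ 22) σ τ refl)

  tribonacci⋆dilate₂ : ∀ n s t → + 88 * (seq tribonacci s ⋆ seq (dilate (+ 2) tribonacci) t) n
    ≡ seq (dilate (+ 3) tribonacci) (⟦ φ ⟧ s t) n + seq sextic (⟦ ω ⟧ s t) n
  tribonacci⋆dilate₂ = Splitting.⋆-split₂ tribonacci (dilate (+ 2) tribonacci) (+ 88) _ ⟦ φ ⟧ _ ⟦ ω ⟧ φ-law ω-law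
    (bilinear-base₂ (+ 88) φ ω refl)

  tribonacci⋆pairSum : ∀ n s t → + 22 * (seq tribonacci s ⋆ seq pairSum t) n
    ≡ seq constant (⟦ κ ⟧ s t) n + seq sextic (⟦ χ ⟧ s t) n
  tribonacci⋆pairSum = Splitting.⋆-split₂ tribonacci pairSum (+ 22) _ ⟦ κ ⟧ _ ⟦ χ ⟧ κ-law χ-law
    (bilinear-base₂ (+ 22) κ χ refl)

  constant⋆dilate₋₁ : ∀ n s t → + 1 * (seq constant s ⋆ seq (dilate (- + 1) tribonacci) t) n ≡ seq pairSum (⟦ ψ ⟧ s t) n
  constant⋆dilate₋₁ = Splitting.⋆-split₁ constant (dilate (- + 1) tribonacci) (+ 1) _ ⟦ ψ ⟧ ψ-law
    (bilinear-base₁ (+ 1) ψ refl)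

  P₂ P₃ P₋ : ℕ → ℤ
  P₂ k = (+ 2) ^ k * Trib (+ 2) (+ 3) (+ 10) k
  P₃ k = (+ 3) ^ k * Trib (+ 3) (+ 3) (+ 5) k
  P₋ k = (- + 1) ^ k * Trib (- + 1) (+ 2) (+ 7) k

  one : ℕ → ℤ
  one _ = + 1

  T≡seq : ∀ n → T n ≡ seq tribonacci (window T 0) n
  T≡seq = Solves⇒≡seq tribonacci T (Trib-solves (+ 0) (+ 1) (+ 1))

  v₀ : Vec ℤ 3
  v₀ = ⟦ ψ ⟧ (+ 1 ∷ []) (window P₋ 0)

  V W : ℕ → ℤ
  V = seq pairSum v₀
  W = seq sextic (⟦ χ ⟧ (window T 0) v₀)

  one⋆P₋≡V : ∀ n → (one ⋆ P₋) n ≡ V n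
  one⋆P₋≡V n = begin
    (one ⋆ P₋) n
      ≡⟨ ⋆-congˡ P₋ (λ k → sym (seq-constant (+ 1) k)) n ⟩
    (seq constant (+ 1 ∷ []) ⋆ P₋) n
      ≡⟨ ⋆-congʳ (seq constant (+ 1 ∷ [])) (dilated-Trib≡seq (- + 1) (- + 1) (+ 2) (+ 7)) n ⟩
    (seq constant (+ 1 ∷ []) ⋆ seq (dilate (- + 1) tribonacci) (window P₋ 0)) n
      ≡⟨ sym (ℤₚ.*-identityˡ _) ⟩
    + 1 * (seq constant (+ 1 ∷ []) ⋆ seq (dilate (- + 1) tribonacci) (window P₋ 0)) n
      ≡⟨ constant⋆dilate₋₁ n (+ 1 ∷ []) (window P₋ 0) ⟩
    V n ∎

  T⋆T-split : ∀ n → + 22 * (T ⋆ T) n ≡ P₂ n + + 2 * V n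
  T⋆T-split n = begin
    + 22 * (T ⋆ T) n
      ≡⟨ cong (+ 22 *_) (trans (⋆-congˡ T T≡seq n) (⋆-congʳ (seq tribonacci (window T 0)) T≡seq n)) ⟩
    + 22 * (seq tribonacci (window T 0) ⋆ seq tribonacci (window T 0)) n
      ≡⟨ tribonacci⋆tribonacci n (window T 0) (window T 0) ⟩
    seq (dilate (+ 2) tribonacci) (window P₂ 0) n + seq pairSum (+ 2 ⊙ v₀) n
      ≡⟨ cong₂ _+_ (sym (dilated-Trib≡seq (+ 2) (+ 2) (+ 3) (+ 10) n)) (seq-⊙ pairSum n (+ 2) v₀) ⟩
    P₂ n + + 2 * V n ∎

  T⋆P₂-split : ∀ n → + 88 * (T ⋆ P₂) n ≡ + 44 * P₃ n + + 4 * W n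
  T⋆P₂-split n = begin
    + 88 * (T ⋆ P₂) n
      ≡⟨ cong (+ 88 *_) (trans (⋆-congˡ P₂ T≡seq n)
                               (⋆-congʳ (seq tribonacci (window T 0)) (dilated-Trib≡seq (+ 2) (+ 2) (+ 3) (+ 10)) n)) ⟩
    + 88 * (seq tribonacci (window T 0) ⋆ seq (dilate (+ 2) tribonacci) (window P₂ 0)) n
      ≡⟨ tribonacci⋆dilate₂ n (window T 0) (window P₂ 0) ⟩
    seq (dilate (+ 3) tribonacci) (+ 44 ⊙ window P₃ 0) n + seq sextic (+ 4 ⊙ ⟦ χ ⟧ (window T 0) v₀) n
      ≡⟨ cong₂ _+_ (trans (seq-⊙ _ n (+ 44) (window P₃ 0)) (cong (+ 44 *_) (sym (dilated-Trib≡seq (+ 3) (+ 3) (+ 3) (+ 5) n))))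
                   (seq-⊙ sextic n (+ 4) (⟦ χ ⟧ (window T 0) v₀)) ⟩
    + 44 * P₃ n + + 4 * W n ∎

  T⋆V-split : ∀ n → + 22 * (T ⋆ V) n ≡ + 33 + W n
  T⋆V-split n = begin
    + 22 * (T ⋆ V) n                         ≡⟨ cong (+ 22 *_) (⋆-congˡ V T≡seq n) ⟩
    + 22 * (seq tribonacci (window T 0) ⋆ V) n ≡⟨ tribonacci⋆pairSum n (window T 0) v₀ ⟩
    seq constant (+ 33 ∷ []) n + W n         ≡⟨ cong (_+ W n) (seq-constant (+ 33) n) ⟩
    + 33 + W n                               ∎

  P₋⋆[T⋆one]≡T⋆V : ∀ n → (P₋ ⋆ (T ⋆ one)) n ≡ (T ⋆ V) n
  P₋⋆[T⋆one]≡T⋆V n = begin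
    (P₋ ⋆ (T ⋆ one)) n   ≡⟨ ⋆-comm P₋ (T ⋆ one) n ⟩
    ((T ⋆ one) ⋆ P₋) n   ≡⟨ ⋆-assoc T one P₋ n ⟩
    (T ⋆ (one ⋆ P₋)) n   ≡⟨ ⋆-congʳ T one⋆P₋≡V n ⟩
    (T ⋆ V) n            ∎

  T⋆[T⋆T]-split : ∀ n → + 22 * (T ⋆ (T ⋆ T)) n ≡ (T ⋆ P₂) n + + 2 * (T ⋆ V) n
  T⋆[T⋆T]-split n = begin
    + 22 * (T ⋆ (T ⋆ T)) n                  ≡⟨ sym (⋆-*ʳ T (+ 22) (T ⋆ T) n) ⟩
    (T ⋆ (λ m → + 22 * (T ⋆ T) m)) n        ≡⟨ ⋆-congʳ T T⋆T-split n ⟩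
    (T ⋆ (λ m → P₂ m + + 2 * V m)) n        ≡⟨ ⋆-distribˡ-+ T P₂ (λ m → + 2 * V m) n ⟩
    (T ⋆ P₂) n + (T ⋆ (λ m → + 2 * V m)) n  ≡⟨ cong (_+_ ((T ⋆ P₂) n)) (⋆-*ʳ T (+ 2) V n) ⟩
    (T ⋆ P₂) n + + 2 * (T ⋆ V) n            ∎

  P₃≡T⋆P₂-T⋆V : ∀ n → P₃ n ≡ + 2 * (T ⋆ P₂) n + - + 2 * (T ⋆ V) n + + 3
  P₃≡T⋆P₂-T⋆V n = ℤₚ.*-cancelˡ-≡ (+ 44) (P₃ n) _ (begin
    + 44 * P₃ n
      ≡⟨ add-zero (P₃ n) (W n) ⟩
    + 44 * P₃ n + + 4 * W n + - + 4 * (+ 33 + W n) + + 132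
      ≡⟨ cong₂ (λ x y → x + - + 4 * y + + 132) (sym (T⋆P₂-split n)) (sym (T⋆V-split n)) ⟩
    + 88 * (T ⋆ P₂) n + - + 4 * (+ 22 * (T ⋆ V) n) + + 132
      ≡⟨ regroup ((T ⋆ P₂) n) ((T ⋆ V) n) ⟩
    + 44 * (+ 2 * (T ⋆ P₂) n + - + 2 * (T ⋆ V) n + + 3) ∎)
    where
    add-zero : ∀ g w → + 44 * g ≡ + 44 * g + + 4 * w + - + 4 * (+ 33 + w) + + 132
    add-zero = solve-∀
    regroup : ∀ a b → + 88 * a + - + 4 * (+ 22 * b) + + 132 ≡ + 44 * (+ 2 * a + - + 2 * b + + 3)
    regroup = solve-∀

-- Passing to ℚ

open import Data.Rational using (ℚ; mkℚ; 0ℚ; _+_; _*_; _/_; _-_)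
import Data.Rational as ℚ
import Data.Rational.Properties as ℚₚ
import Data.Rational.Solver as ℚ-Solver

q : ℤ → ℚ
q z = z / 1

c : ℕ → ℚ
c m = + m / 1

q≡mkℚ : ∀ z → q z ≡ mkℚ z 0 (Coprimality.sym (Coprimality.1-coprimeTo ℤ.∣ z ∣))
q≡mkℚ z = ℚₚ.↥p/↧p≡p _

q-+ : ∀ x y → q (x ℤ.+ y) ≡ q x + q y
q-+ x y = trans (cong (_/ 1) (cong₂ ℤ._+_ (sym (ℤₚ.*-identityʳ x)) (sym (ℤₚ.*-identityʳ y))))
               (sym (cong₂ _+_ (q≡mkℚ x) (q≡mkℚ y)))

q-* : ∀ x y → q (x ℤ.* y) ≡ q x * q y
q-* x y = sym (cong₂ _*_ (q≡mkℚ x) (q≡mkℚ y))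

sumTo-cong : ∀ n {f g : ℕ → ℚ} → (∀ {k} → k ≤ n → f k ≡ g k) → sumTo n f ≡ sumTo n g
sumTo-cong zero f≗g = f≗g z≤n
sumTo-cong (suc n) f≗g = cong₂ _+_ (sumTo-cong n (f≗g ∘ ℕₚ.m≤n⇒m≤1+n)) (f≗g ℕₚ.≤-refl)

sumTo-q : ∀ n (f : ℕ → ℤ) → sumTo n (λ k → q (f k)) ≡ q (∑ n f)
sumTo-q zero f = refl
sumTo-q (suc n) f = trans (cong (_+ q (f (suc n))) (sumTo-q n f)) (sym (q-+ (∑ n f) (f (suc n))))

C*k!*[n∸k]!≡n! : ∀ {n k} → k ≤ n → (n C k) ℕ.* (k ! ℕ.* (n ∸ k) !) ≡ n !
C*k!*[n∸k]!≡n! {n} {k} k≤n =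
  trans (cong (ℕ._* (k ! ℕ.* (n ∸ k) !)) (nCk≡n!/k![n-k]! k≤n)) (m/n*n≡m (k![n∸k]!∣n! k≤n))
  where instance _ = k ℕₚ.!* (n ∸ k) !≢0

multinomial3≡C*C : ∀ n k₁ k₂ → k₁ ≤ n → k₂ ≤ n ∸ k₁ →
                   multinomial3 n k₁ k₂ (n ∸ k₁ ∸ k₂) ≡ (n C k₁) ℕ.* ((n ∸ k₁) C k₂)
multinomial3≡C*C n k₁ k₂ k₁≤n k₂≤m =
  trans (/-congˡ (sym n!≡)) (m*n/n≡m ((n C k₁) ℕ.* (m C k₂)) ((k₁ ! ℕ.* k₂ !) ℕ.* (m ∸ k₂) !))
  where
  m = n ∸ k₁
  instance
    _ = ℕₚ.m*n≢0 (k₁ ! ℕ.* k₂ !) ((m ∸ k₂) !) {{ℕₚ.m*n≢0 (k₁ !) (k₂ !) {{k₁ ℕₚ.!≢0}} {{k₂ ℕₚ.!≢0}}}} {{(m ∸ k₂) ℕₚ.!≢0}}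
  regroup : ∀ a b x y z → (a ℕ.* b) ℕ.* ((x ℕ.* y) ℕ.* z) ≡ a ℕ.* (x ℕ.* (b ℕ.* (y ℕ.* z)))
  regroup = ℕ-Solver.solve-∀
  n!≡ : ((n C k₁) ℕ.* (m C k₂)) ℕ.* ((k₁ ! ℕ.* k₂ !) ℕ.* (m ∸ k₂) !) ≡ n !
  n!≡ = begin
    ((n C k₁) ℕ.* (m C k₂)) ℕ.* ((k₁ ! ℕ.* k₂ !) ℕ.* (m ∸ k₂) !)  ≡⟨ regroup (n C k₁) (m C k₂) (k₁ !) (k₂ !) ((m ∸ k₂) !) ⟩
    (n C k₁) ℕ.* (k₁ ! ℕ.* ((m C k₂) ℕ.* (k₂ ! ℕ.* (m ∸ k₂) !)))  ≡⟨ cong (λ x → (n C k₁) ℕ.* (k₁ ! ℕ.* x)) (C*k!*[n∸k]!≡n! k₂≤m) ⟩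
    (n C k₁) ℕ.* (k₁ ! ℕ.* m !)                              ≡⟨ C*k!*[n∸k]!≡n! k₁≤n ⟩
    n !                                                      ∎

q-*₃ : ∀ x y z → q (x ℤ.* y ℤ.* z) ≡ q x * q y * q z
q-*₃ x y z = trans (q-* (x ℤ.* y) z) (cong (_* q z) (q-* x y))

sumTo-⋆ : ∀ n f g → sumTo n (λ k → c (n C k) * q (f k) * q (g (n ∸ k))) ≡ q ((f ⋆ g) n)
sumTo-⋆ n f g = trans (sumTo-cong n λ {k} _ → sym (q-*₃ (+ (n C k)) (f k) (g (n ∸ k)))) (sumTo-q n _)

sumComp3-cong : ∀ n {F G : ℕ → ℕ → ℕ → ℚ} → (∀ k₁ k₂ k₃ → F k₁ k₂ k₃ ≡ G k₁ k₂ k₃) →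
                sumComp3 n F ≡ sumComp3 n G
sumComp3-cong n F≗G = sumTo-cong n λ {k₁} _ → sumTo-cong (n ∸ k₁) λ {k₂} _ → F≗G k₁ k₂ _

sumComp3-⋆ : ∀ n f g h →
  sumComp3 n (λ k₁ k₂ k₃ → c (multinomial3 n k₁ k₂ k₃) * q (f k₁) * q (g k₂) * q (h k₃))
  ≡ q ((f ⋆ (g ⋆ h)) n)
sumComp3-⋆ n f g h = trans (sumTo-cong n λ {k₁} → inner k₁) (sumTo-q n _)
  where
  inner : ∀ k₁ → k₁ ≤ n →
    sumTo (n ∸ k₁) (λ k₂ → c (multinomial3 n k₁ k₂ (n ∸ k₁ ∸ k₂)) * q (f k₁) * q (g k₂) * q (h (n ∸ k₁ ∸ k₂)))
    ≡ q (+ (n C k₁) ℤ.* f k₁ ℤ.* (g ⋆ h) (n ∸ k₁))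
  inner k₁ k₁≤n = begin
    sumTo m (λ k₂ → c (multinomial3 n k₁ k₂ (m ∸ k₂)) * q (f k₁) * q (g k₂) * q (h (m ∸ k₂)))
      ≡⟨ sumTo-cong m (λ {k₂} → term k₂) ⟩
    sumTo m (λ k₂ → q (+ (n C k₁) ℤ.* f k₁ ℤ.* (+ (m C k₂) ℤ.* g k₂ ℤ.* h (m ∸ k₂))))
      ≡⟨ sumTo-q m _ ⟩
    q (∑ m (λ k₂ → + (n C k₁) ℤ.* f k₁ ℤ.* (+ (m C k₂) ℤ.* g k₂ ℤ.* h (m ∸ k₂))))
      ≡⟨ cong q (∑-*ˡ m (+ (n C k₁) ℤ.* f k₁) _) ⟩
    q (+ (n C k₁) ℤ.* f k₁ ℤ.* (g ⋆ h) m) ∎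
    where
    m = n ∸ k₁
    regroup : ∀ a b x y z → a ℤ.* b ℤ.* x ℤ.* y ℤ.* z ≡ a ℤ.* x ℤ.* (b ℤ.* y ℤ.* z)
    regroup = solve-∀
    term : ∀ k₂ → k₂ ≤ m →
      c (multinomial3 n k₁ k₂ (m ∸ k₂)) * q (f k₁) * q (g k₂) * q (h (m ∸ k₂))
      ≡ q (+ (n C k₁) ℤ.* f k₁ ℤ.* (+ (m C k₂) ℤ.* g k₂ ℤ.* h (m ∸ k₂)))
    term k₂ k₂≤m = begin
      c (multinomial3 n k₁ k₂ (m ∸ k₂)) * q (f k₁) * q (g k₂) * q (h (m ∸ k₂))
        ≡⟨ cong (λ x → q x * q (f k₁) * q (g k₂) * q (h (m ∸ k₂)))
                (trans (cong +_ (multinomial3≡C*C n k₁ k₂ k₁≤n k₂≤m)) (ℤₚ.pos-* (n C k₁) (m C k₂))) ⟩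
      q (+ (n C k₁) ℤ.* + (m C k₂)) * q (f k₁) * q (g k₂) * q (h (m ∸ k₂))
        ≡⟨ cong (_* q (h (m ∸ k₂))) (sym (q-*₃ (+ (n C k₁) ℤ.* + (m C k₂)) (f k₁) (g k₂))) ⟩
      q (+ (n C k₁) ℤ.* + (m C k₂) ℤ.* f k₁ ℤ.* g k₂) * q (h (m ∸ k₂))
        ≡⟨ sym (q-* (+ (n C k₁) ℤ.* + (m C k₂) ℤ.* f k₁ ℤ.* g k₂) (h (m ∸ k₂))) ⟩
      q (+ (n C k₁) ℤ.* + (m C k₂) ℤ.* f k₁ ℤ.* g k₂ ℤ.* h (m ∸ k₂))
        ≡⟨ cong q (regroup (+ (n C k₁)) (+ (m C k₂)) (f k₁) (g k₂) (h (m ∸ k₂))) ⟩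
      q (+ (n C k₁) ℤ.* f k₁ ℤ.* (+ (m C k₂) ℤ.* g k₂ ℤ.* h (m ∸ k₂))) ∎

sumComp3Pos≡sumComp3 : ∀ n F → (∀ k₂ k₃ → F 0 k₂ k₃ ≡ 0ℚ) → (∀ k₁ k₃ → F k₁ 0 k₃ ≡ 0ℚ) →
                       (∀ k₁ k₂ → F k₁ k₂ 0 ≡ 0ℚ) → sumComp3Pos n F ≡ sumComp3 n F
sumComp3Pos≡sumComp3 n F F₀₋₋ F₋₀₋ F₋₋₀ = sumComp3-cong n positive
  where
  positive : ∀ k₁ k₂ k₃ → (if (1 ℕ.≤ᵇ k₁) ∧ (1 ℕ.≤ᵇ k₂) ∧ (1 ℕ.≤ᵇ k₃) then F k₁ k₂ k₃ else 0ℚ) ≡ F k₁ k₂ k₃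
  positive zero k₂ k₃ = sym (F₀₋₋ k₂ k₃)
  positive (suc k₁) zero k₃ = sym (F₋₀₋ (suc k₁) k₃)
  positive (suc k₁) (suc k₂) zero = sym (F₋₋₀ (suc k₁) (suc k₂))
  positive (suc k₁) (suc k₂) (suc k₃) = refl

rational-identity : ∀ D x a b g → (+ 22 / 1) * x ≡ a + (+ 2 / 1) * b →
  g ≡ (+ 2 / 1) * a + (- + 2 / 1) * b + (+ 3 / 1) →
  x ≡ ((D - (+ 2 / 1)) * (+ 1 / 44)) * g + ((- (+ 3) / 1) * D + (+ 6 / 1)) * (+ 1 / 44)
      + ((ℚ.- D + (+ 3 / 1)) * (+ 1 / 22)) * a + (D * (+ 1 / 22)) * b
rational-identity D x a b g 22x≡ refl = begin
  x                                    ≡⟨ unscale x ⟩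
  (+ 1 / 22) * ((+ 22 / 1) * x)        ≡⟨ cong ((+ 1 / 22) *_) 22x≡ ⟩
  (+ 1 / 22) * (a + (+ 2 / 1) * b)     ≡⟨ expand D a b ⟩
  _                                    ∎
  where
  open ℚ-Solver.+-*-Solver
  unscale : ∀ x → x ≡ (+ 1 / 22) * ((+ 22 / 1) * x)
  unscale = solve 1 (λ x → x := con (+ 1 / 22) :* (con (+ 22 / 1) :* x)) refl
  expand : ∀ D a b → (+ 1 / 22) * (a + (+ 2 / 1) * b)
    ≡ ((D - (+ 2 / 1)) * (+ 1 / 44)) * ((+ 2 / 1) * a + (- + 2 / 1) * b + (+ 3 / 1))
      + ((- (+ 3) / 1) * D + (+ 6 / 1)) * (+ 1 / 44) + ((ℚ.- D + (+ 3 / 1)) * (+ 1 / 22)) * a + (D * (+ 1 / 22)) * b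
  expand = solve 3 (λ D a b → con (+ 1 / 22) :* (a :+ con (+ 2 / 1) :* b) :=
    ((D :- con (+ 2 / 1)) :* con (+ 1 / 44)) :* (con (+ 2 / 1) :* a :+ con (- + 2 / 1) :* b :+ con (+ 3 / 1))
    :+ (con (- (+ 3) / 1) :* D :+ con (+ 6 / 1)) :* con (+ 1 / 44)
    :+ ((:- D :+ con (+ 3 / 1)) :* con (+ 1 / 22)) :* a
    :+ (D :* con (+ 1 / 22)) :* b) refl

module _ where
  open ℚ-Solver.+-*-Solver

  sum-T³ : ∀ n → sumComp3Pos n (λ k₁ k₂ k₃ → c (multinomial3 n k₁ k₂ k₃) * q (T k₁) * q (T k₂) * q (T k₃))
                 ≡ q ((T ⋆ (T ⋆ T)) n)
  sum-T³ n = trans (sumComp3Pos≡sumComp3 n F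
                     (λ k₂ k₃ → zero₁ (c (multinomial3 n 0 k₂ k₃)) (q (T k₂)) (q (T k₃)))
                     (λ k₁ k₃ → zero₂ (c (multinomial3 n k₁ 0 k₃)) (q (T k₁)) (q (T k₃)))
                     (λ k₁ k₂ → zero₃ (c (multinomial3 n k₁ k₂ 0)) (q (T k₁)) (q (T k₂))))
                   (sumComp3-⋆ n T T T)
    where
    F : ℕ → ℕ → ℕ → ℚ
    F k₁ k₂ k₃ = c (multinomial3 n k₁ k₂ k₃) * q (T k₁) * q (T k₂) * q (T k₃)
    zero₁ : ∀ x y z → x * 0ℚ * y * z ≡ 0ℚ
    zero₁ = solve 3 (λ x y z → x :* con 0ℚ :* y :* z := con 0ℚ) refl
    zero₂ : ∀ x y z → x * y * 0ℚ * z ≡ 0ℚ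
    zero₂ = solve 3 (λ x y z → x :* y :* con 0ℚ :* z := con 0ℚ) refl
    zero₃ : ∀ x y z → x * y * z * 0ℚ ≡ 0ℚ
    zero₃ = solve 3 (λ x y z → x :* y :* z :* con 0ℚ := con 0ℚ) refl

  sum-T⋆P₂ : ∀ n → sumTo n (λ k → c (n C k) * q ((+ 2) ℤ.^ (n ∸ k)) * q (Trib (+ 2) (+ 3) (+ 10) (n ∸ k)) * q (T k))
                   ≡ q ((T ⋆ P₂) n)
  sum-T⋆P₂ n = trans (sumTo-cong n λ {k} _ → reorder k) (sumTo-⋆ n T P₂)
    where
    swap : ∀ a x y t → a * x * y * t ≡ a * t * (x * y)
    swap = solve 4 (λ a x y t → a :* x :* y :* t := a :* t :* (x :* y)) refl
    reorder : ∀ k → c (n C k) * q ((+ 2) ℤ.^ (n ∸ k)) * q (Trib (+ 2) (+ 3) (+ 10) (n ∸ k)) * q (T k)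
                  ≡ c (n C k) * q (T k) * q (P₂ (n ∸ k))
    reorder k = trans (swap (c (n C k)) (q ((+ 2) ℤ.^ (n ∸ k))) (q (Trib (+ 2) (+ 3) (+ 10) (n ∸ k))) (q (T k)))
                      (cong (c (n C k) * q (T k) *_) (sym (q-* ((+ 2) ℤ.^ (n ∸ k)) (Trib (+ 2) (+ 3) (+ 10) (n ∸ k)))))

  sum-P₋⋆[T⋆one] : ∀ n → sumComp3 n (λ k₁ k₂ k₃ → c (multinomial3 n k₁ k₂ k₃) * q ((- + 1) ℤ.^ k₁)
                                                    * q (Trib (- + 1) (+ 2) (+ 7) k₁) * q (T k₂))
                         ≡ q ((T ⋆ V) n)
  sum-P₋⋆[T⋆one] n =
    trans (sumComp3-cong n (λ k₁ k₂ k₃ → reorder k₁ k₂ k₃)) (trans (sumComp3-⋆ n P₋ T one) (cong q (P₋⋆[T⋆one]≡T⋆V n)))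
    where
    regroup : ∀ a x y t → a * x * y * t ≡ a * (x * y) * t * (+ 1 / 1)
    regroup = solve 4 (λ a x y t → a :* x :* y :* t := a :* (x :* y) :* t :* con (+ 1 / 1)) refl
    reorder : ∀ k₁ k₂ k₃ → c (multinomial3 n k₁ k₂ k₃) * q ((- + 1) ℤ.^ k₁) * q (Trib (- + 1) (+ 2) (+ 7) k₁) * q (T k₂)
                         ≡ c (multinomial3 n k₁ k₂ k₃) * q (P₋ k₁) * q (T k₂) * q (one k₃)
    reorder k₁ k₂ k₃ =
      trans (regroup (c (multinomial3 n k₁ k₂ k₃)) (q ((- + 1) ℤ.^ k₁)) (q (Trib (- + 1) (+ 2) (+ 7) k₁)) (q (T k₂)))
            (cong (λ x → c (multinomial3 n k₁ k₂ k₃) * x * q (T k₂) * q (one k₃))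
                  (sym (q-* ((- + 1) ℤ.^ k₁) (Trib (- + 1) (+ 2) (+ 7) k₁))))

q-T⋆[T⋆T] : ∀ n → (+ 22 / 1) * q ((T ⋆ (T ⋆ T)) n) ≡ q ((T ⋆ P₂) n) + (+ 2 / 1) * q ((T ⋆ V) n)
q-T⋆[T⋆T] n = begin
  (+ 22 / 1) * q ((T ⋆ (T ⋆ T)) n)          ≡⟨ sym (q-* (+ 22) ((T ⋆ (T ⋆ T)) n)) ⟩
  q (+ 22 ℤ.* (T ⋆ (T ⋆ T)) n)              ≡⟨ cong q (T⋆[T⋆T]-split n) ⟩
  q ((T ⋆ P₂) n ℤ.+ + 2 ℤ.* (T ⋆ V) n)      ≡⟨ q-+ ((T ⋆ P₂) n) _ ⟩
  q ((T ⋆ P₂) n) + q (+ 2 ℤ.* (T ⋆ V) n)    ≡⟨ cong (_+_ (q ((T ⋆ P₂) n))) (q-* (+ 2) ((T ⋆ V) n)) ⟩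
  q ((T ⋆ P₂) n) + (+ 2 / 1) * q ((T ⋆ V) n) ∎

q-P₃ : ∀ n → q (P₃ n) ≡ (+ 2 / 1) * q ((T ⋆ P₂) n) + (- + 2 / 1) * q ((T ⋆ V) n) + (+ 3 / 1)
q-P₃ n = begin
  q (P₃ n)
    ≡⟨ cong q (P₃≡T⋆P₂-T⋆V n) ⟩
  q (+ 2 ℤ.* (T ⋆ P₂) n ℤ.+ - + 2 ℤ.* (T ⋆ V) n ℤ.+ + 3)
    ≡⟨ q-+ (+ 2 ℤ.* (T ⋆ P₂) n ℤ.+ - + 2 ℤ.* (T ⋆ V) n) (+ 3) ⟩
  q (+ 2 ℤ.* (T ⋆ P₂) n ℤ.+ - + 2 ℤ.* (T ⋆ V) n) + (+ 3 / 1)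
    ≡⟨ cong (_+ (+ 3 / 1)) (trans (q-+ (+ 2 ℤ.* (T ⋆ P₂) n) (- + 2 ℤ.* (T ⋆ V) n))
                                  (cong₂ _+_ (q-* (+ 2) ((T ⋆ P₂) n)) (q-* (- + 2) ((T ⋆ V) n)))) ⟩
  (+ 2 / 1) * q ((T ⋆ P₂) n) + (- + 2 / 1) * q ((T ⋆ V) n) + (+ 3 / 1) ∎

theorem2 : (D : ℚ) (n : ℕ) →
  let A = D - (+ 2 / 1)
      B = (- (+ 3) / 1) * D + (+ 6 / 1)
      Cc = ℚ.- D + (+ 3 / 1)
      q = λ (z : ℤ) → z / 1
      c = λ (m : ℕ) → (+ m) / 1
  in sumComp3Pos n (λ k1 k2 k3 → c (multinomial3 n k1 k2 k3) * q (T k1) * q (T k2) * q (T k3))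
     ≡ (A * (+ 1 / 44)) * q ((+ 3) ℤ.^ n) * q (Trib (+ 3) (+ 3) (+ 5) n)
       + B * (+ 1 / 44)
       + (Cc * (+ 1 / 22)) * sumTo n (λ k → c (n C k) * q ((+ 2) ℤ.^ (n ∸ k)) * q (Trib (+ 2) (+ 3) (+ 10) (n ∸ k)) * q (T k))
       + (D * (+ 1 / 22)) * sumComp3 n (λ k1 k2 k3 → c (multinomial3 n k1 k2 k3) * q ((- (+ 1)) ℤ.^ k1) * q (Trib (- (+ 1)) (+ 2) (+ 7) k1) * q (T k2))
theorem2 D n = begin
  _ ≡⟨ sum-T³ n ⟩
  q ((T ⋆ (T ⋆ T)) n)
    ≡⟨ rational-identity D _ _ _ (q (P₃ n)) (q-T⋆[T⋆T] n) (q-P₃ n) ⟩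
  α * q (P₃ n) + β + γ * q ((T ⋆ P₂) n) + δ * q ((T ⋆ V) n)
    ≡⟨ cong₂ _+_ (cong₂ _+_ (cong (_+ β) (trans (cong (α *_) (q-* ((+ 3) ℤ.^ n) _)) (sym (ℚₚ.*-assoc α _ _))))
                            (cong (γ *_) (sym (sum-T⋆P₂ n))))
                 (cong (δ *_) (sym (sum-P₋⋆[T⋆one] n))) ⟩
  _ ∎
  where
  α = (D - (+ 2 / 1)) * (+ 1 / 44)
  β = ((- (+ 3) / 1) * D + (+ 6 / 1)) * (+ 1 / 44)
  γ = (ℚ.- D + (+ 3 / 1)) * (+ 1 / 22)
  δ = D * (+ 1 / 22)
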